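{- Let $H$ be a digraph with a min-max-ordering $a_1<a_2<\dots<a_p$ of $V(H)$, and let $D$ be a digraph. Let the lists $L(x)\subseteq V(H)$, $x\in V(D)$, be obtained by the arc consistency procedure starting from $L(x)=V(H)$ for all $x$. For each $i$, let $\ell^+(i)$ be the smallest $j$ such that $a_ia_j\in A(H)$ and $\ell^-(i)$ the smallest $j$ such that $a_ja_i\in A(H)$. Consider variables $v_i$ for $v\in V(D)$ and $1\le i\le p+1$, and the system $\mathcal S$ of constraints: $v_i\ge0$; $v_1=1$; $v_{p+1}=0$; $v_{i+1}\le v_i$ for $1\le i\le p$; $v_{i+1}=v_i$ whenever $a_i\notin L(v)$; and for every arc $uv\in A(D)$ and every $i$: $u_i\le v_{\ell^+(i)}$ (for those $i$ with $\ell^+(i)$ defined) and $v_i\le u_{\ell^-(i)}$ (for those $i$ with $\ell^-(i)$ defined). Then there is a one-to-one correspondence between homomorphisms of $D$ to $H$ and integer solutions of $\mathcal S$, given by associating to a homomorphism $f$ the solution with $v_i=1$ if $i\le t$ and $v_i=0$ if $i>t$, where $f(v)=a_t$ (conversely, an integer solution corresponds to the map sending $v$ to $a_i$ for the largest $i$ with $v_i=1$).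
   Context: A digraph $H$ has finite vertex set $V(H)$ and arc set $A(H)$. A homomorphism of $D$ to $H$ is a map $f:V(D)\to V(H)$ with $f(x)f(y)\in A(H)$ for all $xy\in A(D)$. A linear ordering $<$ of $V(H)$ is a min-max-ordering if whenever $uv,u'v'\in A(H)$ with $u<u'$ and $v'<v$, both $uv'\in A(H)$ and $u'v\in A(H)$. Arc consistency procedure: repeatedly pick an arc $xy\in A(D)$; remove from $L(x)$ any $a$ having no out-neighbour in $L(y)$, and remove from $L(y)$ any $b$ having no in-neighbour in $L(x)$; stop when no further change is possible. -}

module Defs where

open import Data.Nat using (ℕ; zero; suc; _≤ᵇ_)
open import Data.Fin using (Fin; toℕ; inject₁; fromℕ) renaming (_<_ to _<ᶠ_)
open import Data.Bool using (Bool; true; false; _∧_; if_then_else_)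
open import Data.Integer using (ℤ; +_) renaming (_≤_ to _≤ℤ_)
open import Data.Product using (_×_; Σ)
open import Data.Bool using (_∨_)
open import Relation.Binary.PropositionalEquality using (_≡_)
open import Relation.Nullary using (¬_)

-- A digraph on vertex set Fin n is given by its (decidable) arc relation.
-- The vertices of H are Fin p; the ordering a₁ < … < a_p is the order of Fin p
-- (a_{i} is the vertex with toℕ = i - 1).
Digraph : ℕ → Set
Digraph n = Fin n → Fin n → Bool

Arc : ∀ {n} → Digraph n → Fin n → Fin n → Set
Arc G x y = G x y ≡ true

IsMinMaxOrdering : ∀ {p} → Digraph p → Set
IsMinMaxOrdering {p} H =
  ∀ (u v u′ v′ : Fin p) → Arc H u v → Arc H u′ v′ → u <ᶠ u′ → v′ <ᶠ v →
  Arc H u v′ × Arc H u′ v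

IsHom : ∀ {n p} → Digraph n → Digraph p → (Fin n → Fin p) → Set
IsHom {n} D H f = ∀ (x y : Fin n) → Arc D x y → Arc H (f x) (f y)

Hom : ∀ {n p} → Digraph n → Digraph p → Set
Hom {n} {p} D H = Σ (Fin n → Fin p) (IsHom D H)

anyFin : ∀ {p} → (Fin p → Bool) → Bool
anyFin {zero} f = false
anyFin {suc p} f = f Data.Fin.zero ∨ anyFin (λ b → f (Data.Fin.suc b))

Lists : ℕ → ℕ → Set
Lists n p = Fin n → Fin p → Bool

fullLists : ∀ {n p} → Lists n p
fullLists _ _ = true

-- One step of the arc consistency procedure on the arc xy of D:
-- first remove from L(x) every a with no out-neighbour in L(y),
-- then remove from L(y) every b with no in-neighbour in (the new) L(x).
-- (For x ≢ y the order is irrelevant.)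
updateOut : ∀ {n p} → Digraph p → Fin n → Fin n → Lists n p → Lists n p
updateOut {n} H x y L z a with z Data.Fin.≟ x
... | Relation.Nullary.yes _ = L x a ∧ anyFin (λ b → L y b ∧ H a b)
... | Relation.Nullary.no _ = L z a

updateIn : ∀ {n p} → Digraph p → Fin n → Fin n → Lists n p → Lists n p
updateIn {n} H x y L z b with z Data.Fin.≟ y
... | Relation.Nullary.yes _ = L y b ∧ anyFin (λ a → L x a ∧ H a b)
... | Relation.Nullary.no _ = L z b

revise : ∀ {n p} → Digraph p → Fin n → Fin n → Lists n p → Lists n p
revise H x y L = updateIn H x y (updateOut H x y L)

data Reachable {n p} (D : Digraph n) (H : Digraph p) : Lists n p → Set where
  start : Reachable D H fullLists
  step  : ∀ {L} (x y : Fin n) → Arc D x y → Reachable D H L →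
          Reachable D H (revise H x y L)

Stable : ∀ {n p} → Digraph n → Digraph p → Lists n p → Set
Stable {n} {p} D H L =
  ∀ (x y : Fin n) → Arc D x y → ∀ (z : Fin n) (a : Fin p) → revise H x y L z a ≡ L z a

ACResult : ∀ {n p} → Digraph n → Digraph p → Lists n p → Set
ACResult D H L = Reachable D H L × Stable D H L

IsLeastOut : ∀ {p} → Digraph p → Fin p → Fin p → Set
IsLeastOut {p} H i j = Arc H i j × (∀ (k : Fin p) → k <ᶠ j → ¬ Arc H i k)

IsLeastIn : ∀ {p} → Digraph p → Fin p → Fin p → Set
IsLeastIn {p} H i j = Arc H j i × (∀ (k : Fin p) → k <ᶠ j → ¬ Arc H k i)

-- Assignments to the variables v_i, v ∈ V(D), 1 ≤ i ≤ p+1;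
-- index k : Fin (suc p) stands for v_{k+1}.
Assignment : ℕ → ℕ → Set
Assignment n p = Fin n → Fin (suc p) → ℤ

IsSolution : ∀ {n p} → Digraph n → Digraph p → Lists n p → Assignment n p → Set
IsSolution {n} {p} D H L X =
    (∀ (v : Fin n) (k : Fin (suc p)) → + 0 ≤ℤ X v k)
  × (∀ (v : Fin n) → X v Data.Fin.zero ≡ + 1)
  × (∀ (v : Fin n) → X v (fromℕ p) ≡ + 0)
  × (∀ (v : Fin n) (i : Fin p) → X v (Data.Fin.suc i) ≤ℤ X v (inject₁ i))
  × (∀ (v : Fin n) (i : Fin p) → L v i ≡ false → X v (Data.Fin.suc i) ≡ X v (inject₁ i))
  × (∀ (u v : Fin n) → Arc D u v → ∀ (i j : Fin p) → IsLeastOut H i j →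
        X u (inject₁ i) ≤ℤ X v (inject₁ j))
  × (∀ (u v : Fin n) → Arc D u v → ∀ (i j : Fin p) → IsLeastIn H i j →
        X v (inject₁ i) ≤ℤ X u (inject₁ j))

encode : ∀ {n p} → (Fin n → Fin p) → Assignment n p
encode f v k = if toℕ k ≤ᵇ toℕ (f v) then + 1 else + 0

module Submission where

-- Encoding f(v) = a_t by the 0/1 "threshold" sequence v_1 … v_{p+1}
-- (ones up to position t, zeros after) turns the constraints of 𝒮 into order
-- statements about the values of f.
--  * Threshold sequences: the encoding is injective, and every nonnegative
--    nonincreasing integer sequence from 1 down to 0 IS a threshold sequence.
--  * Min-max orderings: the least out-neighbour ℓ⁺ and least in-neighbour ℓ⁻
--    are monotone along arcs, and an arc i ℓ⁺(i) together with an arc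
--    ℓ⁻(j) j, where ℓ⁻(j) ≤ i and ℓ⁺(i) ≤ j, forces the arc i j.
--  * Arc consistency: values of a homomorphism are never removed from the
--    lists, and in stable lists every value has an out-/in-neighbour in H.
-- Then a homomorphism yields a solution (monotonicity of ℓ⁺, ℓ⁻), and a
-- solution is the encoding of a map whose values lie in the lists (they are
-- the jumps of the sequence) and which maps arcs to arcs (the forcing lemma).

open import Defs
open import Data.Nat as ℕ using (ℕ; zero; suc; _≤ᵇ_; s≤s)
import Data.Nat.Properties as ℕ
open import Data.Fin using (Fin; toℕ; inject₁; fromℕ; _≤_; _<_; _≟_)
open import Data.Fin.Properties
  using (toℕ-injective; toℕ-inject₁; toℕ-fromℕ; toℕ<n; ≤-refl; ≤-antisym; ≤∧≢⇒<; _≤?_)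
open import Data.Bool using (Bool; true; false; _∧_; if_then_else_; T)
open import Data.Bool.Properties using (∧-conicalˡ; ∧-conicalʳ; ∨-zeroʳ; not-¬)
open import Data.Integer as ℤ using (ℤ; +_; +≤+)
import Data.Integer.Properties as ℤ
open import Data.Product using (_×_; Σ; proj₁; proj₂; _,_)
import Data.Product as Product
open import Data.Sum using (_⊎_; inj₁; inj₂)
import Data.Sum as Sum
open import Data.Unit using (tt)
open import Function using (_∘_; id)
open import Relation.Nullary using (¬_; yes; no; contradiction)
open import Relation.Binary.PropositionalEquality
  using (_≡_; _≢_; refl; sym; trans; subst; subst₂)

∧-intro : ∀ {a b : Bool} → a ≡ true → b ≡ true → (a ∧ b) ≡ true
∧-intro refl refl = refl

any-intro : ∀ {p} (P : Fin p → Bool) (b : Fin p) → P b ≡ true → anyFin P ≡ true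
any-intro P Fin.zero Pb rewrite Pb = refl
any-intro P (Fin.suc b) Pb rewrite any-intro (λ c → P (Fin.suc c)) b Pb = ∨-zeroʳ (P Fin.zero)

any-elim : ∀ {p} (P : Fin p → Bool) → anyFin P ≡ true → Σ (Fin p) λ b → P b ≡ true
any-elim {suc p} P any with P Fin.zero in P₀
... | true = Fin.zero , P₀
... | false = Product.map Fin.suc id (any-elim (λ c → P (Fin.suc c)) any)

least : ∀ {p} (P : Fin p → Bool) (b : Fin p) → P b ≡ true →
  Σ (Fin p) λ j → P j ≡ true × (∀ k → k < j → P k ≢ true)
least P Fin.zero Pb = Fin.zero , Pb , λ _ ()
least P (Fin.suc b) Pb with P Fin.zero in P₀
... | true = Fin.zero , P₀ , λ _ ()
... | false with least (λ c → P (Fin.suc c)) b Pb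
...   | j , Pj , below = Fin.suc j , Pj , below′
  where
  below′ : ∀ k → k < Fin.suc j → P k ≢ true
  below′ Fin.zero _ = not-¬ P₀
  below′ (Fin.suc k) k<j = below k (ℕ.s<s⁻¹ k<j)

≤⇒<⊎≡ : ∀ {m} {i j : Fin m} → i ≤ j → i < j ⊎ i ≡ j
≤⇒<⊎≡ i≤j = Sum.map₂ toℕ-injective (ℕ.m≤n⇒m<n∨m≡n i≤j)

inject₁-≤⁺ : ∀ {m n} {i : Fin m} {t : Fin n} → i ≤ t → inject₁ i ≤ t
inject₁-≤⁺ {i = i} {t} = subst (ℕ._≤ toℕ t) (sym (toℕ-inject₁ i))

inject₁-≤⁻ : ∀ {m n} {i : Fin m} {t : Fin n} → inject₁ i ≤ t → i ≤ t
inject₁-≤⁻ {i = i} {t} = subst (ℕ._≤ toℕ t) (toℕ-inject₁ i)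

-- Threshold sequences

indicator : Bool → ℤ
indicator b = if b then + 1 else + 0

indicator-true : ∀ {b} → T b → indicator b ≡ + 1
indicator-true {true} _ = refl

indicator-false : ∀ {b} → ¬ T b → indicator b ≡ + 0
indicator-false {true} ¬b = contradiction tt ¬b
indicator-false {false} _ = refl

indicator-nonneg : ∀ b → + 0 ℤ.≤ indicator b
indicator-nonneg true = +≤+ ℕ.z≤n
indicator-nonneg false = +≤+ ℕ.z≤n

indicator-positive : ∀ {b} → + 1 ℤ.≤ indicator b → T b
indicator-positive {true} _ = tt
indicator-positive {false} (+≤+ ())

threshold : ∀ {p} → Fin p → Fin (suc p) → ℤ
threshold t k = indicator (toℕ k ≤ᵇ toℕ t)

module _ {p : ℕ} (t : Fin p) where

  threshold-≤ : ∀ (k : Fin (suc p)) → k ≤ t → threshold t k ≡ + 1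
  threshold-≤ k k≤t = indicator-true (ℕ.≤⇒≤ᵇ k≤t)

  threshold-> : ∀ (k : Fin (suc p)) → t < k → threshold t k ≡ + 0
  threshold-> k t<k = indicator-false (ℕ.<⇒≱ t<k ∘ ℕ.≤ᵇ⇒≤ (toℕ k) (toℕ t))

  threshold-nonneg : ∀ (k : Fin (suc p)) → + 0 ℤ.≤ threshold t k
  threshold-nonneg k = indicator-nonneg (toℕ k ≤ᵇ toℕ t)

  threshold-positive : ∀ (k : Fin (suc p)) → + 1 ℤ.≤ threshold t k → k ≤ t
  threshold-positive k = ℕ.≤ᵇ⇒≤ (toℕ k) (toℕ t) ∘ indicator-positive

  threshold-self : threshold t (inject₁ t) ≡ + 1
  threshold-self = threshold-≤ (inject₁ t) (inject₁-≤⁺ ≤-refl)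

  threshold-jumps : threshold t (Fin.suc t) ≢ threshold t (inject₁ t)
  threshold-jumps rewrite threshold-> (Fin.suc t) (ℕ.n<1+n (toℕ t)) | threshold-self = λ ()

  threshold-last : threshold t (fromℕ p) ≡ + 0
  threshold-last = threshold-> (fromℕ p) (subst (toℕ t ℕ.<_) (sym (toℕ-fromℕ p)) (toℕ<n t))

threshold-mono : ∀ {p} (t t′ : Fin p) (k k′ : Fin (suc p)) →
  (k ≤ t → k′ ≤ t′) → threshold t k ℤ.≤ threshold t′ k′
threshold-mono t t′ k k′ k≤t⇒k′≤t′ with k ≤? t
... | yes k≤t rewrite threshold-≤ t k k≤t | threshold-≤ t′ k′ (k≤t⇒k′≤t′ k≤t) = ℤ.≤-refl
... | no k≰t rewrite threshold-> t k (ℕ.≰⇒> k≰t) = threshold-nonneg t′ k′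

threshold-nonincreasing : ∀ {p} (t i : Fin p) →
  threshold t (Fin.suc i) ℤ.≤ threshold t (inject₁ i)
threshold-nonincreasing t i = threshold-mono t t (Fin.suc i) (inject₁ i) (inject₁-≤⁺ ∘ ℕ.<⇒≤)

threshold-flat : ∀ {p} (t i : Fin p) → i ≢ t →
  threshold t (Fin.suc i) ≡ threshold t (inject₁ i)
threshold-flat t i i≢t =
  ℤ.≤-antisym (threshold-nonincreasing t i)
              (threshold-mono t t (inject₁ i) (Fin.suc i) λ i≤t → ≤∧≢⇒< (inject₁-≤⁻ i≤t) i≢t)

threshold-suc : ∀ {p} (t : Fin p) (k : Fin (suc p)) →
  threshold (Fin.suc t) (Fin.suc k) ≡ threshold t k
threshold-suc t Fin.zero = refl
threshold-suc t (Fin.suc k) = refl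

threshold-transfer : ∀ {p} (t t′ j : Fin p) →
  threshold t (inject₁ t) ℤ.≤ threshold t′ (inject₁ j) → j ≤ t′
threshold-transfer t t′ j le =
  inject₁-≤⁻ (threshold-positive t′ (inject₁ j) (subst (ℤ._≤ _) (threshold-self t) le))

threshold-injective : ∀ {p} (t t′ : Fin p) →
  (∀ k → threshold t k ≡ threshold t′ k) → t ≡ t′
threshold-injective t t′ same =
  ≤-antisym (threshold-transfer t t′ t (ℤ.≤-reflexive (same (inject₁ t))))
            (threshold-transfer t′ t t′ (ℤ.≤-reflexive (sym (same (inject₁ t′)))))

Nonincreasing : ∀ {p} → (Fin (suc p) → ℤ) → Set
Nonincreasing {p} s = ∀ (i : Fin p) → s (Fin.suc i) ℤ.≤ s (inject₁ i)

≤-head : ∀ {p} (s : Fin (suc p) → ℤ) → Nonincreasing s → ∀ k → s k ℤ.≤ s Fin.zero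
≤-head s dec Fin.zero = ℤ.≤-refl
≤-head {suc p} s dec (Fin.suc k) = ℤ.≤-trans (≤-head (s ∘ Fin.suc) (dec ∘ Fin.suc) k) (dec Fin.zero)

zero-or-one : ∀ {x} → + 0 ℤ.≤ x → x ℤ.≤ + 1 → x ≡ + 0 ⊎ x ≡ + 1
zero-or-one {+ 0} _ _ = inj₁ refl
zero-or-one {+ 1} _ _ = inj₂ refl
zero-or-one {+ suc (suc _)} _ (+≤+ (s≤s ()))

staircase : ∀ {p} (s : Fin (suc p) → ℤ) → (∀ k → + 0 ℤ.≤ s k) → Nonincreasing s →
  s Fin.zero ≡ + 1 → s (fromℕ p) ≡ + 0 → Σ (Fin p) λ t → ∀ k → s k ≡ threshold t k
staircase {zero} s _ _ s₀≡1 s₀≡0 = contradiction (trans (sym s₀≡1) s₀≡0) λ ()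
staircase {suc p} s nonneg dec s₀≡1 sₚ≡0
  with zero-or-one (nonneg (Fin.suc Fin.zero)) (subst (s (Fin.suc Fin.zero) ℤ.≤_) s₀≡1 (dec Fin.zero))
... | inj₁ s₁≡0 = Fin.zero , drops-at-zero
  where
  drops-at-zero : ∀ k → s k ≡ threshold Fin.zero k
  drops-at-zero Fin.zero = s₀≡1
  drops-at-zero (Fin.suc k) =
    ℤ.≤-antisym (subst (s (Fin.suc k) ℤ.≤_) s₁≡0 (≤-head (s ∘ Fin.suc) (dec ∘ Fin.suc) k))
                (nonneg (Fin.suc k))
... | inj₂ s₁≡1 with staircase (s ∘ Fin.suc) (nonneg ∘ Fin.suc) (dec ∘ Fin.suc) s₁≡1 sₚ≡0
...   | t , tail = Fin.suc t , shifted
  where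
  shifted : ∀ k → s k ≡ threshold (Fin.suc t) k
  shifted Fin.zero = s₀≡1
  shifted (Fin.suc k) = trans (tail k) (sym (threshold-suc t k))

-- Min-max orderings

module _ {p : ℕ} {H : Digraph p} (minmax : IsMinMaxOrdering H) where

  minmax-weak : ∀ {u v u′ v′} → Arc H u v → Arc H u′ v′ → u ≤ u′ → v′ ≤ v →
    Arc H u v′ × Arc H u′ v
  minmax-weak {u} {v} {u′} {v′} uv u′v′ u≤u′ v′≤v with ≤⇒<⊎≡ u≤u′ | ≤⇒<⊎≡ v′≤v
  ... | inj₂ refl | _ = u′v′ , uv
  ... | inj₁ _ | inj₂ refl = uv , u′v′
  ... | inj₁ u<u′ | inj₁ v′<v = minmax u v u′ v′ uv u′v′ u<u′ v′<v

  leastOut-monotone : ∀ {u v i j} → Arc H u v → IsLeastOut H i j → i ≤ u → j ≤ v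
  leastOut-monotone uv (ij , below) i≤u =
    ℕ.≮⇒≥ λ v<j → below _ v<j (proj₁ (minmax-weak ij uv i≤u (ℕ.<⇒≤ v<j)))

  leastIn-monotone : ∀ {u v i j} → Arc H u v → IsLeastIn H i j → i ≤ v → j ≤ u
  leastIn-monotone uv (ji , below) i≤v =
    ℕ.≮⇒≥ λ u<j → below _ u<j (proj₁ (minmax-weak uv ji (ℕ.<⇒≤ u<j) i≤v))

  minmax-fill : ∀ {i j i′ j′} → Arc H i j′ → Arc H i′ j → i′ ≤ i → j′ ≤ j → Arc H i j
  minmax-fill ij′ i′j i′≤i j′≤j = proj₂ (minmax-weak i′j ij′ i′≤i j′≤j)

leastOut-exists : ∀ {p} (H : Digraph p) (i : Fin p) →
  Σ (Fin p) (Arc H i) → Σ (Fin p) (IsLeastOut H i)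
leastOut-exists H i (b , ib) = least (H i) b ib

leastIn-exists : ∀ {p} (H : Digraph p) (i : Fin p) →
  Σ (Fin p) (λ b → Arc H b i) → Σ (Fin p) (IsLeastIn H i)
leastIn-exists H i (b , bi) = least (λ k → H k i) b bi

-- Arc consistency

module _ {n p : ℕ} (H : Digraph p) where

  updateOut-at : ∀ (x y : Fin n) L a →
    updateOut H x y L x a ≡ (L x a ∧ anyFin (λ b → L y b ∧ H a b))
  updateOut-at x y L a with x ≟ x
  ... | yes _ = refl
  ... | no x≢x = contradiction refl x≢x

  updateIn-at : ∀ (x y : Fin n) L b →
    updateIn H x y L y b ≡ (L y b ∧ anyFin (λ a → L x a ∧ H a b))
  updateIn-at x y L b with y ≟ y
  ... | yes _ = refl
  ... | no y≢y = contradiction refl y≢y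

  updateIn-⊆ : ∀ (x y z : Fin n) L a → updateIn H x y L z a ≡ true → L z a ≡ true
  updateIn-⊆ x y z L a kept with z ≟ y
  ... | yes refl = ∧-conicalˡ _ _ kept
  ... | no _ = kept

  updateOut-keeps : ∀ {x y : Fin n} {L} (f : Fin n → Fin p) → Arc H (f x) (f y) →
    (∀ z → L z (f z) ≡ true) → ∀ z → updateOut H x y L z (f z) ≡ true
  updateOut-keeps {x} {y} {L} f fxy inL z with z ≟ x
  ... | yes refl = ∧-intro (inL z) (any-intro (λ b → L y b ∧ H (f z) b) (f y) (∧-intro (inL y) fxy))
  ... | no _ = inL z

  updateIn-keeps : ∀ {x y : Fin n} {L} (f : Fin n → Fin p) → Arc H (f x) (f y) →
    (∀ z → L z (f z) ≡ true) → ∀ z → updateIn H x y L z (f z) ≡ true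
  updateIn-keeps {x} {y} {L} f fxy inL z with z ≟ y
  ... | yes refl = ∧-intro (inL z) (any-intro (λ a → L x a ∧ H a (f z)) (f x) (∧-intro (inL x) fxy))
  ... | no _ = inL z

module _ {n p : ℕ} {D : Digraph n} {H : Digraph p} where

  hom-within-lists : ∀ {L} → Reachable D H L → (f : Fin n → Fin p) → IsHom D H f →
    ∀ z → L z (f z) ≡ true
  hom-within-lists start f hom z = refl
  hom-within-lists (step x y xy r) f hom =
    updateIn-keeps H f (hom x y xy) (updateOut-keeps H f (hom x y xy) (hom-within-lists r f hom))

  stable-out : ∀ {L} → Stable D H L → ∀ {x y} → Arc D x y → ∀ {a} → L x a ≡ true →
    Σ (Fin p) λ b → Arc H a b
  stable-out {L} stable {x} {y} xy {a} a∈Lx =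
    Product.map id (∧-conicalʳ _ _) (any-elim _ (∧-conicalʳ _ _ survives))
    where
    survives : (L x a ∧ anyFin (λ b → L y b ∧ H a b)) ≡ true
    survives = trans (sym (updateOut-at H x y L a))
      (updateIn-⊆ H x y x (updateOut H x y L) a (trans (stable x y xy x a) a∈Lx))

  stable-in : ∀ {L} → Stable D H L → ∀ {x y} → Arc D x y → ∀ {b} → L y b ≡ true →
    Σ (Fin p) λ a → Arc H a b
  stable-in {L} stable {x} {y} xy {b} b∈Ly =
    Product.map id (∧-conicalʳ _ _)
      (any-elim _ (∧-conicalʳ _ _ (trans (sym (updateIn-at H x y (updateOut H x y L) b))
                                          (trans (stable x y xy y b) b∈Ly))))

-- The correspondence

module _ {n p : ℕ} {D : Digraph n} {H : Digraph p} {L : Lists n p} where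

  hom⇒solution : IsMinMaxOrdering H → Reachable D H L →
    ∀ (f : Fin n → Fin p) → IsHom D H f → IsSolution D H L (encode f)
  hom⇒solution minmax reach f hom =
      (λ v → threshold-nonneg (f v))
    , (λ _ → refl)
    , (λ v → threshold-last (f v))
    , (λ v → threshold-nonincreasing (f v))
    , (λ v i i∉Lv → threshold-flat (f v) i λ i≡fv →
         not-¬ i∉Lv (subst (λ a → L v a ≡ true) (sym i≡fv) (hom-within-lists reach f hom v)))
    , (λ u v uv i j ℓ⁺ → threshold-mono (f u) (f v) (inject₁ i) (inject₁ j)
         (inject₁-≤⁺ ∘ leastOut-monotone minmax (hom u v uv) ℓ⁺ ∘ inject₁-≤⁻))
    , (λ u v uv i j ℓ⁻ → threshold-mono (f v) (f u) (inject₁ i) (inject₁ j)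
         (inject₁-≤⁺ ∘ leastIn-monotone minmax (hom u v uv) ℓ⁻ ∘ inject₁-≤⁻))

  solution-respects : ∀ {X Y : Assignment n p} → (∀ v k → X v k ≡ Y v k) →
    IsSolution D H L X → IsSolution D H L Y
  solution-respects X≗Y (nonneg , first , last , dec , flat , outC , inC) =
      (λ v k → subst (+ 0 ℤ.≤_) (X≗Y v k) (nonneg v k))
    , (λ v → trans (sym (X≗Y v _)) (first v))
    , (λ v → trans (sym (X≗Y v _)) (last v))
    , (λ v i → subst₂ ℤ._≤_ (X≗Y v _) (X≗Y v _) (dec v i))
    , (λ v i i∉Lv → trans (sym (X≗Y v _)) (trans (flat v i i∉Lv) (X≗Y v _)))
    , (λ u v uv i j ℓ⁺ → subst₂ ℤ._≤_ (X≗Y u _) (X≗Y v _) (outC u v uv i j ℓ⁺))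
    , (λ u v uv i j ℓ⁻ → subst₂ ℤ._≤_ (X≗Y v _) (X≗Y u _) (inC u v uv i j ℓ⁻))

  solution⇒encoding : ∀ {X : Assignment n p} → IsSolution D H L X →
    Σ (Fin n → Fin p) λ f → ∀ v k → X v k ≡ encode f v k
  solution⇒encoding {X} (nonneg , first , last , dec , _) =
    (proj₁ ∘ staircase′) , (proj₂ ∘ staircase′)
    where
    staircase′ : ∀ v → Σ (Fin p) λ t → ∀ k → X v k ≡ threshold t k
    staircase′ v = staircase (X v) (nonneg v) (dec v) (first v) (last v)

  -- If encode f solves 𝒮, every f v lies in L(v): the sequence must drop at f v.
  encoding-within-lists : ∀ (f : Fin n → Fin p) → IsSolution D H L (encode f) →
    ∀ v → L v (f v) ≡ true
  encoding-within-lists f (_ , _ , _ , _ , flat , _) v with L v (f v) in fv∉Lv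
  ... | true = refl
  ... | false = contradiction (flat v (f v) fv∉Lv) (threshold-jumps (f v))

  encoding⇒hom : IsMinMaxOrdering H → Stable D H L →
    ∀ (f : Fin n → Fin p) → IsSolution D H L (encode f) → IsHom D H f
  encoding⇒hom minmax stable f sol@(_ , _ , _ , _ , _ , outC , inC) u v uv =
    minmax-fill minmax (proj₁ (proj₂ ℓ⁺)) (proj₁ (proj₂ ℓ⁻)) ℓ⁻≤fu ℓ⁺≤fv
    where
    inL = encoding-within-lists f sol
    ℓ⁺ : Σ (Fin p) (IsLeastOut H (f u))
    ℓ⁺ = leastOut-exists H (f u) (stable-out stable uv (inL u))
    ℓ⁻ : Σ (Fin p) (IsLeastIn H (f v))
    ℓ⁻ = leastIn-exists H (f v) (stable-in stable uv (inL v))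
    ℓ⁺≤fv : proj₁ ℓ⁺ ≤ f v
    ℓ⁺≤fv = threshold-transfer (f u) (f v) (proj₁ ℓ⁺) (outC u v uv (f u) (proj₁ ℓ⁺) (proj₂ ℓ⁺))
    ℓ⁻≤fu : proj₁ ℓ⁻ ≤ f u
    ℓ⁻≤fu = threshold-transfer (f v) (f u) (proj₁ ℓ⁻) (inC u v uv (f v) (proj₁ ℓ⁻) (proj₂ ℓ⁻))

theorem5 : ∀ {n p : ℕ} (D : Digraph n) (H : Digraph p) → IsMinMaxOrdering H →
    ∀ (L : Lists n p) → ACResult D H L →
      (∀ (h : Hom D H) → IsSolution D H L (encode (proj₁ h)))
      × (∀ (g h : Hom D H) →
           (∀ (v : Fin n) (k : Fin _) → encode (proj₁ g) v k ≡ encode (proj₁ h) v k) →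
           ∀ (v : Fin n) → proj₁ g v ≡ proj₁ h v)
      × (∀ (X : Assignment n p) → IsSolution D H L X →
           Σ (Hom D H) (λ h → ∀ (v : Fin n) (k : Fin _) → encode (proj₁ h) v k ≡ X v k))
theorem5 D H minmax L (reach , stable) =
    (λ (f , hom) → hom⇒solution minmax reach f hom)
  , (λ (g , _) (h , _) same v → threshold-injective (g v) (h v) (same v))
  , decode
  where
  decode : ∀ X → IsSolution D H L X →
    Σ (Hom D H) (λ h → ∀ v k → encode (proj₁ h) v k ≡ X v k)
  decode X sol with solution⇒encoding sol
  ... | f , X≗f =
    (f , encoding⇒hom minmax stable f (solution-respects X≗f sol)) , λ v k → sym (X≗f v k)
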